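{- For every integer $N\ge 5$, $L_N(M_2)=1+\frac{1}{N}$.
   Context: $B_N$ denotes the Boolean lattice of all subsets of $[N]=\{1,\dots,N\}$ ordered by inclusion. The $2$-matching $M_2$ is the poset on $\{x_1,x_2,y_1,y_2\}$ with $x_1\le y_1$, $x_2\le y_2$ and all other pairs of distinct elements incomparable. A family $\mathcal{F}\subseteq B_N$ is $M_2$-free if there is no injection $f:M_2\to\mathcal{F}$ with $f(x)\subseteq f(y)$ whenever $x\le y$ in $M_2$. The Lubell function is $\operatorname{lu}_N(\mathcal{F})=\sum_{F\in\mathcal{F}}\binom{N}{|F|}^{ -1}$, and $L_N(M_2)=\max\{\operatorname{lu}_N(\mathcal{F}):\mathcal{F}\subseteq B_N\setminus\{\emptyset,[N]\},\ \mathcal{F}\text{ is }M_2\text{ -free}\}$. -}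

module Defs where

open import Data.Nat using (ℕ; zero; suc)
open import Data.Nat.Combinatorics using (_C_)
open import Data.Integer using (+_)
open import Data.Rational using (ℚ; _/_; _+_; 0ℚ)
open import Data.Fin using (Fin; zero; suc)
open import Data.Fin.Subset using (Subset; _⊆_; ⊥; ⊤; ∣_∣)
open import Data.List using (List; []; _∷_)
open import Data.List.Membership.Propositional using (_∈_)
open import Data.List.Relation.Unary.Unique.Propositional using (Unique)
open import Data.Product using (Σ; _×_)
open import Relation.Nullary using (¬_)
open import Relation.Binary.PropositionalEquality using (_≡_; _≢_)
open import Function.Definitions using (Injective)

-- Reciprocal of a natural number as a rational (recip 0 = 0 by convention;
-- only ever applied to nonzero numbers below: binomials N C k with k ≤ N, and N ≥ 5).
recip : ℕ → ℚ
recip zero    = 0ℚ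
recip (suc m) = + 1 / suc m

-- The poset M₂ on Fin 4: 0 = x₁, 1 = x₂, 2 = y₁, 3 = y₂.
-- Order relation (reflexive, plus x₁ ≤ y₁ and x₂ ≤ y₂).
data _≤M₂_ : Fin 4 → Fin 4 → Set where
  refl≤  : ∀ {i} → i ≤M₂ i
  x₁≤y₁ : zero ≤M₂ suc (suc zero)
  x₂≤y₂ : suc zero ≤M₂ suc (suc (suc zero))

-- A family of subsets of [N] is a duplicate-free list of subsets.
-- F is M₂-free: there is no injection f : M₂ → F with f x ⊆ f y whenever x ≤ y.
M₂-free : (N : ℕ) → List (Subset N) → Set
M₂-free N F =
  ¬ Σ (Fin 4 → Subset N) (λ f →
      Injective _≡_ _≡_ f
    × (∀ i → f i ∈ F)
    × (∀ {i j} → i ≤M₂ j → f i ⊆ f j))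

lu : (N : ℕ) → List (Subset N) → ℚ
lu N []      = 0ℚ
lu N (A ∷ F) = recip (N C ∣ A ∣) + lu N F

Admissible : (N : ℕ) → List (Subset N) → Set
Admissible N F =
    Unique F
  × (∀ {A} → A ∈ F → A ≢ ⊥)
  × (∀ {A} → A ∈ F → A ≢ ⊤)
  × M₂-free N F

-- Double counting over the N! maximal chains c of B_N gives N! · lu_N(F) = Σ_c |F ∩ c|.
-- Two disjoint comparable pairs of F would form a copy of M₂, so the comparability graph of F
-- is edgeless, a star with centre Z, or a triangle X, Y, W.  Each chain meets F in a clique of
-- that graph: in at most one set, plus one if it passes through Z, plus one for each pair of
-- {X, Y, W} it contains.  A set ∅ ≠ Z ≠ [N] lies on at most (N-1)! chains, a pair
-- ∅ ≠ P ⊊ Q ≠ [N] on at most (N-2)!, and 3 (N-2)! ≤ (N-1)! once N ≥ 4; hence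
-- N! · lu_N(F) ≤ N! + (N-1)!.  The family {1} ∪ {[N] ∖ {i} : i ∈ [N]} attains the bound.
module Submission where

open import Defs

module LubellBound where

  open import Data.Bool using (Bool; true; false; _∧_; _∨_; not; T) renaming (_≟_ to _≟ᵇ_)
  open import Data.Bool.Properties using (∧-idem; ∧-comm; T-∧; T-∨)
  open import Data.Empty using (⊥-elim)
  open import Data.Fin using (Fin; zero; suc; toℕ)
  open import Data.Fin.Patterns using (0F; 1F; 2F; 3F)
  open import Data.Fin.Properties using () renaming (_≟_ to _≟ᶠ_)
  open import Data.Fin.Subset using (Subset; _⊆_; ∣_∣; ⊥; ⊤; ⁅_⁆; ∁; inside; outside) renaming (_∈_ to _∈ₛ_)
  open import Data.Fin.Subset.Properties
    using ( _⊆?_; ⊆-min; ⊆-max; ⊆-refl; drop-∷-⊆; out⊆; in⊆in; p⊆q⇒∣p∣≤∣q∣; ∣p∣≤n; ∣⊥∣≡0; ∣⊤∣≡n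
          ; ∣⁅x⁆∣≡1; ∣∁p∣≡n∸∣p∣; x∈⁅x⁆; x∈⁅y⁆⇒x≡y; x∈∁p⇒x∉p; x∉p⇒x∈∁p )
  open import Data.Integer as ℤ using (+_)
  import Data.Integer.Properties as ℤₚ
  open import Data.List using (List; []; _∷_; tabulate)
  open import Data.List.Membership.Propositional using (_∈_; find; lose)
  open import Data.List.Membership.Propositional.Properties using (∈-tabulate⁻)
  open import Data.List.Relation.Unary.All as All using ()
  import Data.List.Relation.Unary.All.Properties as Allₚ
  open import Data.List.Relation.Unary.AllPairs using (_∷_)
  open import Data.List.Relation.Unary.Any using (here; there; any?)
  open import Data.List.Relation.Unary.Unique.Propositional using (Unique)
  import Data.List.Relation.Unary.Unique.Propositional.Properties as Uniqueₚ
  open import Data.Nat using (ℕ; zero; suc; _+_; _*_; _∸_; _!; _≤_; _<_; _<ᵇ_; z≤n; s≤s; s≤s⁻¹; NonZero)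
  open import Data.Nat.Combinatorics using (_C_; nCk≡n!/k![n-k]!; k![n∸k]!∣n!; nC1≡n; nCk≡nC[n∸k])
  open import Data.Nat.Coprimality as Coprime using (1-coprimeTo)
  open import Data.Nat.DivMod using (m/n*n≡m)
  open import Data.Nat.Properties
  open import Algebra.Properties.CommutativeSemigroup +-commutativeSemigroup using (interchange)
  open import Algebra.Properties.CommutativeSemigroup *-commutativeSemigroup using (x∙yz≈y∙xz)
  open import Data.Nat.Tactic.RingSolver using (solve-∀)
  open import Data.Product using (Σ; ∃; ∃₂; _×_; _,_; proj₂)
  open import Data.Rational as ℚ using (ℚ; mkℚ; 1ℚ; NonNegative)
  import Data.Rational.Properties as ℚₚ
  open import Data.Sum using (_⊎_; inj₁; inj₂; [_,_]′; swap)
  import Data.Unit as Unit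
  open import Data.Unit using (tt)
  open import Data.Vec using ([]; _∷_; here)
  open import Data.Vec.Properties using (≡-dec)
  open import Function using (_∘_; id; Equivalence)
  open import Function.Definitions using (Injective)
  open import Relation.Binary.Definitions using (DecidableEquality; Decidable; Symmetric)
  open import Relation.Binary.PropositionalEquality
  open import Relation.Nullary using (¬_; Dec; yes; no; contradiction; ¬?)
  open import Relation.Nullary.Decidable using (⌊_⌋; map′; _×-dec_; _⊎-dec_; T?; toWitness; fromWitness; toWitnessFalse)
  open import Algebra.Properties.Semiring.Sum +-*-semiring
    using (sum; sum-syntax; sum-cong-≗; ∑-distrib-+; *-distribˡ-sum; *-distribʳ-sum; sum-replicate-zero)
  open Equivalence using (to; from)

  fromℕ : ℕ → ℚ
  fromℕ n = mkℚ (+ n) 0 (Coprime.sym (1-coprimeTo n))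

  n/1≡fromℕ : ∀ n → + n ℚ./ 1 ≡ fromℕ n
  n/1≡fromℕ n = ℚₚ.normalize-coprime (Coprime.sym (1-coprimeTo n))

  fromℕ-+ : ∀ m n → fromℕ (m + n) ≡ fromℕ m ℚ.+ fromℕ n
  fromℕ-+ m n = begin
    fromℕ (m + n)                       ≡⟨ n/1≡fromℕ (m + n) ⟨
    + (m + n) ℚ./ 1                     ≡⟨ ℚₚ./-cong numerator refl ⟩
    (+ m ℤ.* + 1 ℤ.+ + n ℤ.* + 1) ℚ./ 1 ≡⟨⟩
    fromℕ m ℚ.+ fromℕ n                 ∎
    where
    open ≡-Reasoning
    numerator : + (m + n) ≡ + m ℤ.* + 1 ℤ.+ + n ℤ.* + 1
    numerator = trans (ℤₚ.pos-+ m n) (sym (cong₂ ℤ._+_ (ℤₚ.*-identityʳ (+ m)) (ℤₚ.*-identityʳ (+ n))))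

  fromℕ-* : ∀ m n → fromℕ (m * n) ≡ fromℕ m ℚ.* fromℕ n
  fromℕ-* m n = begin
    fromℕ (m * n)         ≡⟨ n/1≡fromℕ (m * n) ⟨
    + (m * n) ℚ./ 1       ≡⟨ ℚₚ./-cong (ℤₚ.pos-* m n) refl ⟩
    (+ m ℤ.* + n) ℚ./ 1   ≡⟨⟩
    fromℕ m ℚ.* fromℕ n   ∎
    where open ≡-Reasoning

  fromℕ-mono-≤ : ∀ {m n} → m ≤ n → fromℕ m ℚ.≤ fromℕ n
  fromℕ-mono-≤ {m} {n} m≤n =
    ℚ.*≤* (subst₂ ℤ._≤_ (sym (ℤₚ.*-identityʳ (+ m))) (sym (ℤₚ.*-identityʳ (+ n))) (ℤ.+≤+ m≤n))

  recip-nonNeg : ∀ n → NonNegative (recip n)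
  recip-nonNeg zero    = _
  recip-nonNeg (suc n) = ℚₚ.normalize-nonNeg 1 (suc n)

  recip≡1/fromℕ : ∀ n → recip (suc n) ≡ ℚ.1/ fromℕ (suc n)
  recip≡1/fromℕ n = ℚₚ.normalize-coprime (1-coprimeTo (suc n))

  recip-inverseˡ : ∀ n .{{_ : NonZero n}} → recip n ℚ.* fromℕ n ≡ 1ℚ
  recip-inverseˡ (suc n) = trans (cong (ℚ._* fromℕ (suc n)) (recip≡1/fromℕ n)) (ℚₚ.*-inverseˡ (fromℕ (suc n)))

  recip-inverseʳ : ∀ n .{{_ : NonZero n}} → fromℕ n ℚ.* recip n ≡ 1ℚ
  recip-inverseʳ (suc n) = trans (cong (fromℕ (suc n) ℚ.*_) (recip≡1/fromℕ n)) (ℚₚ.*-inverseʳ (fromℕ (suc n)))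

  recip-* : ∀ {m n d} .{{_ : NonZero d}} → m * n ≡ d → recip m ≡ fromℕ n ℚ.* recip d
  recip-* {m} {n} {d} refl = begin
    recip m                                      ≡⟨ ℚₚ.*-identityʳ (recip m) ⟨
    recip m ℚ.* 1ℚ                               ≡⟨ cong (recip m ℚ.*_) (recip-inverseʳ d) ⟨
    recip m ℚ.* (fromℕ (m * n) ℚ.* r)            ≡⟨ cong (λ x → recip m ℚ.* (x ℚ.* r)) (fromℕ-* m n) ⟩
    recip m ℚ.* ((fromℕ m ℚ.* fromℕ n) ℚ.* r)    ≡⟨ cong (recip m ℚ.*_) (ℚₚ.*-assoc (fromℕ m) (fromℕ n) r) ⟩
    recip m ℚ.* (fromℕ m ℚ.* (fromℕ n ℚ.* r))    ≡⟨ ℚₚ.*-assoc (recip m) (fromℕ m) (fromℕ n ℚ.* r) ⟨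
    (recip m ℚ.* fromℕ m) ℚ.* (fromℕ n ℚ.* r)    ≡⟨ cong (ℚ._* (fromℕ n ℚ.* r)) (recip-inverseˡ m {{m*n≢0⇒m≢0 m}}) ⟩
    1ℚ ℚ.* (fromℕ n ℚ.* r)                       ≡⟨ ℚₚ.*-identityˡ (fromℕ n ℚ.* r) ⟩
    fromℕ n ℚ.* r                                ∎
    where
    open ≡-Reasoning
    r = recip d

  𝟙 : Bool → ℕ
  𝟙 true  = 1
  𝟙 false = 0

  count : {V : Set} → (V → Bool) → List V → ℕ
  count p []       = 0
  count p (x ∷ xs) = 𝟙 (p x) + count p xs

  module _ {V : Set} where

    count-≡0 : ∀ {p : V → Bool} xs → (∀ {x} → x ∈ xs → ¬ T (p x)) → count p xs ≡ 0
    count-≡0 {p} []       _ = refl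
    count-≡0 {p} (x ∷ xs) ¬p with p x in px
    ... | true  = contradiction (subst T (sym px) _) (¬p (here refl))
    ... | false = count-≡0 xs (¬p ∘ there)

    count-≤1 : ∀ {p : V → Bool} {xs} → Unique xs →
      (∀ {x y} → x ∈ xs → y ∈ xs → T (p x) → T (p y) → x ≡ y) → count p xs ≤ 1
    count-≤1 {p} {[]}     _             _      = z≤n
    count-≤1 {p} {x ∷ xs} (x∉xs ∷ uniq) p-same with p x in px
    ... | true  = ≤-reflexive (cong suc (count-≡0 xs λ y∈xs py →
                    All.lookup x∉xs y∈xs (p-same (here refl) (there y∈xs) (subst T (sym px) _) py)))
    ... | false = count-≤1 uniq (λ x∈ y∈ → p-same (there x∈) (there y∈))

    count-mono : ∀ {p q : V → Bool} xs → (∀ {x} → x ∈ xs → T (p x) → T (q x)) → count p xs ≤ count q xs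
    count-mono         []       _   = z≤n
    count-mono {p} {q} (x ∷ xs) p⇒q = +-mono-≤ (𝟙-mono (p⇒q (here refl))) (count-mono xs (p⇒q ∘ there))
      where
      𝟙-mono : ∀ {a b} → (T a → T b) → 𝟙 a ≤ 𝟙 b
      𝟙-mono {false}         _   = z≤n
      𝟙-mono {true}  {true}  _   = ≤-refl
      𝟙-mono {true}  {false} a⇒b = ⊥-elim (a⇒b _)

    count-∨ : ∀ (p q : V → Bool) xs → count (λ x → p x ∨ q x) xs ≤ count p xs + count q xs
    count-∨ p q []       = z≤n
    count-∨ p q (x ∷ xs) = ≤-trans (+-mono-≤ (𝟙-∨ (p x) (q x)) (count-∨ p q xs))
                                   (≤-reflexive (interchange (𝟙 (p x)) (𝟙 (q x)) (count p xs) (count q xs)))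
      where
      𝟙-∨ : ∀ a b → 𝟙 (a ∨ b) ≤ 𝟙 a + 𝟙 b
      𝟙-∨ false b     = ≤-refl
      𝟙-∨ true  false = ≤-refl
      𝟙-∨ true  true  = s≤s z≤n

  module _ {V : Set} (_≟_ : DecidableEquality V) where

    open import Data.List.Membership.DecPropositional _≟_ using (_∈?_)

    count-≟-≤ : ∀ (p : V → Bool) y {xs} → Unique xs → count (λ x → p x ∧ ⌊ x ≟ y ⌋) xs ≤ 𝟙 (p y)
    count-≟-≤ p y {xs} uniq with p y in py
    ... | true  = count-≤1 uniq λ _ _ hx hx' → trans (≡y hx) (sym (≡y hx'))
      where
      ≡y : ∀ {x} → T (p x ∧ ⌊ x ≟ y ⌋) → x ≡ y
      ≡y {x} h = toWitness (proj₂ (to (T-∧ {p x} {⌊ x ≟ y ⌋}) h))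
    ... | false = ≤-reflexive (count-≡0 xs λ {x} _ h →
                    let px , x≡y = to (T-∧ {p x} {⌊ x ≟ y ⌋}) h in subst T (trans (cong p (toWitness x≡y)) py) px)

    count-⊆ : ∀ (p : V → Bool) {xs} ys → Unique xs → (∀ {x} → x ∈ xs → T (p x) → x ∈ ys) →
      count p xs ≤ count p ys
    count-⊆ p {xs} ys uniq p⇒∈ys =
      ≤-trans (count-mono xs (λ x∈xs px → from T-∧ (px , fromWitness (p⇒∈ys x∈xs px)))) (restrict ys)
      where
      restrict : ∀ ys → count (λ x → p x ∧ ⌊ x ∈? ys ⌋) xs ≤ count p ys
      restrict []       = ≤-reflexive (count-≡0 xs λ {x} _ h → proj₂ (to (T-∧ {p x} {⌊ x ∈? [] ⌋}) h))
      restrict (y ∷ ys) = begin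
        count (λ x → p x ∧ ⌊ x ∈? y ∷ ys ⌋) xs
          ≤⟨ count-mono xs (λ {x} _ h → split (to (T-∧ {p x} {⌊ x ∈? y ∷ ys ⌋}) h)) ⟩
        count (λ x → (p x ∧ ⌊ x ≟ y ⌋) ∨ (p x ∧ ⌊ x ∈? ys ⌋)) xs
          ≤⟨ count-∨ _ _ xs ⟩
        count (λ x → p x ∧ ⌊ x ≟ y ⌋) xs + count (λ x → p x ∧ ⌊ x ∈? ys ⌋) xs
          ≤⟨ +-mono-≤ (count-≟-≤ p y uniq) (restrict ys) ⟩
        𝟙 (p y) + count p ys ∎
        where
        open ≤-Reasoning
        split : ∀ {x} → T (p x) × T ⌊ x ∈? y ∷ ys ⌋ → T ((p x ∧ ⌊ x ≟ y ⌋) ∨ (p x ∧ ⌊ x ∈? ys ⌋))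
        split (px , x∈) with toWitness x∈
        ... | here  x≡y  = from T-∨ (inj₁ (from T-∧ (px , fromWitness x≡y)))
        ... | there x∈ys = from T-∨ (inj₂ (from T-∧ (px , fromWitness x∈ys)))

  -- Graphs without two disjoint edges

  module TwoMatchingFreeGraph {V : Set} (_≟_ : DecidableEquality V)
    {_~_ : V → V → Set} (_~?_ : Decidable _~_) (~-sym : Symmetric _~_) (xs : List V) where

    open import Data.List.Membership.DecPropositional _≟_ using (_∈?_)

    record Edge (P Q : V) : Set where
      constructor edge
      field
        ∈ˡ       : P ∈ xs
        ∈ʳ       : Q ∈ xs
        distinct : P ≢ Q
        adjacent : P ~ Q
    open Edge

    edge-sym : ∀ {P Q} → Edge P Q → Edge Q P
    edge-sym (edge P∈ Q∈ P≢Q P~Q) = edge Q∈ P∈ (P≢Q ∘ sym) (~-sym P~Q)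

    TwoMatchingFree : Set
    TwoMatchingFree = ∀ {P Q R S} → Edge P Q → Edge R S → ¬ (P ≢ R × P ≢ S × Q ≢ R × Q ≢ S)

    data Shape : Set where
      edgeless : (∀ {P Q} → ¬ Edge P Q) → Shape
      star     : ∀ Z → Z ∈ xs → (∀ {P Q} → Edge P Q → P ≡ Z ⊎ Q ≡ Z) → Shape
      triangle : ∀ X Y W → Edge X Y → Edge X W → Edge Y W →
                 (∀ {P Q} → Edge P Q → P ∈ X ∷ Y ∷ W ∷ []) → Shape

    private
      ∃∈? : {P : V → Set} → (∀ x → Dec (P x)) → ∀ ys → Dec (∃ λ x → x ∈ ys × P x)
      ∃∈? P? ys = map′ find (λ (_ , x∈ , px) → lose x∈ px) (any? P? ys)

    edge? : Dec (∃₂ Edge)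
    edge? = map′ (λ (P , P∈ , Q , Q∈ , P≢Q , P~Q) → P , Q , edge P∈ Q∈ P≢Q P~Q)
                 (λ (P , Q , edge P∈ Q∈ P≢Q P~Q) → P , P∈ , Q , Q∈ , P≢Q , P~Q)
                 (∃∈? (λ P → ∃∈? (λ Q → ¬? (P ≟ Q) ×-dec P ~? Q) xs) xs)

    module _ (two-matching-free : TwoMatchingFree) where

      star-or-branch : ∀ {X Y} → Edge X Y →
        (∀ {P Q} → Edge P Q → P ≡ Y ⊎ Q ≡ Y) ⊎ (∃ λ W → Edge X W × W ≢ Y)
      star-or-branch {X} {Y} eXY with ∃∈? (λ W → ¬? (X ≟ W) ×-dec ¬? (W ≟ Y) ×-dec X ~? W) xs
      ... | yes (W , W∈ , X≢W , W≢Y , X~W) = inj₂ (W , edge (∈ˡ eXY) W∈ X≢W X~W , W≢Y)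
      ... | no no-branch = inj₁ at-Y
        where
        at-Y : ∀ {P Q} → Edge P Q → P ≡ Y ⊎ Q ≡ Y
        at-Y {P} {Q} e with P ≟ Y | Q ≟ Y
        ... | yes P≡Y | _       = inj₁ P≡Y
        ... | no _    | yes Q≡Y = inj₂ Q≡Y
        ... | no P≢Y  | no Q≢Y with P ≟ X | Q ≟ X
        ...   | yes refl | _        = ⊥-elim (no-branch (Q , ∈ʳ e , distinct e , Q≢Y , adjacent e))
        ...   | no _     | yes refl = ⊥-elim (no-branch (P , ∈ˡ e , distinct e ∘ sym , P≢Y , ~-sym (adjacent e)))
        ...   | no P≢X   | no Q≢X   = ⊥-elim (two-matching-free e eXY (P≢X , P≢Y , Q≢X , Q≢Y))

      shape : Shape
      shape with edge?
      ... | no no-edge = edgeless (λ e → no-edge (_ , _ , e))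
      ... | yes (X , Y , eXY) with star-or-branch eXY | star-or-branch (edge-sym eXY)
      ...   | inj₁ at-Y | _         = star Y (∈ʳ eXY) at-Y
      ...   | inj₂ _    | inj₁ at-X = star X (∈ˡ eXY) at-X
      ...   | inj₂ (W , eXW , W≢Y) | inj₂ (U , eYU , U≢X) with W ≟ U
      ...     | no W≢U   = ⊥-elim (two-matching-free eXW eYU (distinct eXY , U≢X ∘ sym , W≢Y , W≢U))
      ...     | yes refl = triangle X Y W eXY eXW eYU in-triangle
        where
        in-triangle : ∀ {P Q} → Edge P Q → P ∈ X ∷ Y ∷ W ∷ []
        in-triangle {P} {Q} e with P ≟ X | P ≟ Y | P ≟ W
        ... | yes P≡X | _       | _       = here P≡X
        ... | _       | yes P≡Y | _       = there (here P≡Y)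
        ... | _       | _       | yes P≡W = there (there (here P≡W))
        ... | no P≢X  | no P≢Y  | no P≢W with Q ≟ X | Q ≟ Y
        ...   | yes refl | _        = ⊥-elim (two-matching-free e eYU (P≢Y , P≢W , distinct eXY , distinct eXW))
        ...   | _        | yes refl = ⊥-elim (two-matching-free e eXW (P≢X , P≢W , distinct eXY ∘ sym , distinct eYU))
        ...   | no Q≢X   | no Q≢Y   = ⊥-elim (two-matching-free e eXY (P≢X , P≢Y , Q≢X , Q≢Y))

    excess : Shape → (V → Bool) → ℕ
    excess (edgeless _)             p = 0
    excess (star Z _ _)             p = 𝟙 (p Z)
    excess (triangle X Y W _ _ _ _) p = 𝟙 (p X ∧ p Y) + 𝟙 (p X ∧ p W) + 𝟙 (p Y ∧ p W)

    module _ (uniq : Unique xs) (p : V → Bool)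
             (p-clique : ∀ {P Q} → P ∈ xs → Q ∈ xs → T (p P) → T (p Q) → P ~ Q) where

      equal-or-edge : ∀ {P Q} → P ∈ xs → Q ∈ xs → T (p P) → T (p Q) → P ≡ Q ⊎ Edge P Q
      equal-or-edge {P} {Q} P∈ Q∈ pP pQ with P ≟ Q
      ... | yes P≡Q = inj₁ P≡Q
      ... | no  P≢Q = inj₂ (edge P∈ Q∈ P≢Q (p-clique P∈ Q∈ pP pQ))

      count-edgeless : (∀ {P Q} → ¬ Edge P Q) → count p xs ≤ 1
      count-edgeless no-edge = count-≤1 uniq λ P∈ Q∈ pP pQ →
        [ id , ⊥-elim ∘ no-edge ]′ (equal-or-edge P∈ Q∈ pP pQ)

      count-star : ∀ Z → (∀ {P Q} → Edge P Q → P ≡ Z ⊎ Q ≡ Z) → count p xs ≤ 1 + 𝟙 (p Z)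
      count-star Z at-Z = begin
        count p xs                                                  ≤⟨ count-mono xs (λ {x} _ → split x) ⟩
        count (λ x → (p x ∧ ⌊ x ≟ Z ⌋) ∨ (p x ∧ not ⌊ x ≟ Z ⌋)) xs  ≤⟨ count-∨ _ _ xs ⟩
        count (λ x → p x ∧ ⌊ x ≟ Z ⌋) xs + count (λ x → p x ∧ not ⌊ x ≟ Z ⌋) xs
          ≤⟨ +-mono-≤ (count-≟-≤ _≟_ p Z uniq) (count-≤1 uniq off-Z-equal) ⟩
        𝟙 (p Z) + 1                                                 ≡⟨ +-comm (𝟙 (p Z)) 1 ⟩
        1 + 𝟙 (p Z)                                                 ∎
        where
        open ≤-Reasoning
        split : ∀ x → T (p x) → T ((p x ∧ ⌊ x ≟ Z ⌋) ∨ (p x ∧ not ⌊ x ≟ Z ⌋))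
        split x px with x ≟ Z
        ... | yes _ = from T-∨ (inj₁ (from T-∧ (px , _)))
        ... | no  _ = from T-∨ (inj₂ (from T-∧ (px , _)))
        off-Z-equal : ∀ {x y} → x ∈ xs → y ∈ xs → T (p x ∧ not ⌊ x ≟ Z ⌋) → T (p y ∧ not ⌊ y ≟ Z ⌋) → x ≡ y
        off-Z-equal {x} {y} x∈ y∈ hx hy
          with px , x≢Z ← to (T-∧ {p x}) hx | py , y≢Z ← to (T-∧ {p y}) hy
          with equal-or-edge x∈ y∈ px py
        ... | inj₁ x≡y = x≡y
        ... | inj₂ e with at-Z e
        ...   | inj₁ x≡Z = ⊥-elim (toWitnessFalse x≢Z x≡Z)
        ...   | inj₂ y≡Z = ⊥-elim (toWitnessFalse y≢Z y≡Z)

      count-triangle : ∀ X Y W → (∀ {P Q} → Edge P Q → P ∈ X ∷ Y ∷ W ∷ []) →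
        count p xs ≤ 1 + (𝟙 (p X ∧ p Y) + 𝟙 (p X ∧ p W) + 𝟙 (p Y ∧ p W))
      count-triangle X Y W in-triangle with ∃∈? (λ x → T? (p x) ×-dec ¬? (x ∈? X ∷ Y ∷ W ∷ [])) xs
      ... | yes (P , P∈ , pP , P∉T) = ≤-trans (count-≤1 uniq all-P) (m≤m+n 1 _)
        where
        ≡P : ∀ {x} → x ∈ xs → T (p x) → x ≡ P
        ≡P x∈ px = [ id , (λ e → ⊥-elim (P∉T (in-triangle (edge-sym e)))) ]′ (equal-or-edge x∈ P∈ px pP)
        all-P : ∀ {x y} → x ∈ xs → y ∈ xs → T (p x) → T (p y) → x ≡ y
        all-P x∈ y∈ px py = trans (≡P x∈ px) (sym (≡P y∈ py))
      ... | no no-outsider = ≤-trans (count-⊆ _≟_ p (X ∷ Y ∷ W ∷ []) uniq in-T) (𝟙-sum≤1+pairs (p X) (p Y) (p W))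
        where
        in-T : ∀ {x} → x ∈ xs → T (p x) → x ∈ X ∷ Y ∷ W ∷ []
        in-T {x} x∈ px with x ∈? X ∷ Y ∷ W ∷ []
        ... | yes x∈T = x∈T
        ... | no  x∉T = ⊥-elim (no-outsider (x , x∈ , px , x∉T))
        𝟙-sum≤1+pairs : ∀ a b c → 𝟙 a + (𝟙 b + (𝟙 c + 0)) ≤ 1 + (𝟙 (a ∧ b) + 𝟙 (a ∧ c) + 𝟙 (b ∧ c))
        𝟙-sum≤1+pairs false false false = z≤n
        𝟙-sum≤1+pairs false false true  = ≤-refl
        𝟙-sum≤1+pairs false true  false = ≤-refl
        𝟙-sum≤1+pairs false true  true  = ≤-refl
        𝟙-sum≤1+pairs true  false false = ≤-refl
        𝟙-sum≤1+pairs true  false true  = ≤-refl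
        𝟙-sum≤1+pairs true  true  false = ≤-refl
        𝟙-sum≤1+pairs true  true  true  = s≤s (s≤s (s≤s z≤n))

      count-≤-excess : ∀ s → count p xs ≤ 1 + excess s p
      count-≤-excess (edgeless no-edge)                  = count-edgeless no-edge
      count-≤-excess (star Z _ at-Z)                     = count-star Z at-Z
      count-≤-excess (triangle X Y W _ _ _ in-triangle)  = count-triangle X Y W in-triangle

  -- Maximal chains

  𝟙-∧-interchange : ∀ a b x y → 𝟙 ((a ∧ x) ∧ (b ∧ y)) ≡ 𝟙 (a ∧ b) * 𝟙 (x ∧ y)
  𝟙-∧-interchange false b     x     y = refl
  𝟙-∧-interchange true  false false y = refl
  𝟙-∧-interchange true  false true  y = refl
  𝟙-∧-interchange true  true  x     y = sym (+-identityʳ (𝟙 (x ∧ y)))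

  ∑-const : ∀ m k → ∑[ j < m ] k ≡ m * k
  ∑-const zero    k = refl
  ∑-const (suc m) k = cong (_+_ k) (∑-const m k)

  ∑-mono-≤ : ∀ {m} {f g : Fin m → ℕ} → (∀ j → f j ≤ g j) → sum f ≤ sum g
  ∑-mono-≤ {zero}  f≤g = z≤n
  ∑-mono-≤ {suc m} f≤g = +-mono-≤ (f≤g zero) (∑-mono-≤ (f≤g ∘ suc))

  ∑-above : ∀ m a b → a ≤ b → ∑[ j < m ] 𝟙 ((a <ᵇ suc (toℕ j)) ∧ (b <ᵇ suc (toℕ j))) ≡ m ∸ b
  ∑-above zero    a       b       _         = sym (0∸n≡0 b)
  ∑-above (suc m) zero    zero    _         = cong suc (∑-above m 0 0 z≤n)
  ∑-above (suc m) zero    (suc b) _         = ∑-above m 0 b z≤n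
  ∑-above (suc m) (suc a) (suc b) (s≤s a≤b) = ∑-above m a b a≤b

  ∑-between : ∀ m a b → a ≤ suc b → b < m → ∑[ j < m ] 𝟙 ((a <ᵇ suc (toℕ j)) ∧ (toℕ j <ᵇ suc b)) ≡ suc b ∸ a
  ∑-between (suc m) zero       zero    _                 _         = cong suc (sum-replicate-zero m)
  ∑-between (suc m) zero       (suc b) _                 (s≤s b<m) = cong suc (∑-between m 0 b z≤n b<m)
  ∑-between (suc m) (suc zero) zero    _                 _         = sum-replicate-zero m
  ∑-between (suc m) (suc a)    (suc b) (s≤s a≤1+b)       (s≤s b<m) = ∑-between m a b a≤1+b b<m

  ∑-below : ∀ m a b → a ≤ b → a < m → ∑[ j < m ] 𝟙 ((toℕ j <ᵇ suc a) ∧ (toℕ j <ᵇ suc b)) ≡ suc a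
  ∑-below (suc m) zero    b       _         _         = cong suc (sum-replicate-zero m)
  ∑-below (suc m) (suc a) (suc b) (s≤s a≤b) (s≤s a<m) = cong suc (∑-below m a b a≤b a<m)

  -- (j , c) is the maximal chain of B_(suc n) that follows c on the last n coordinates and
  -- adds the first coordinate right after its set of size j.  Levels are compared with _<ᵇ_
  -- (m ≤ n as m <ᵇ suc n) because suc m <ᵇ suc n reduces to m <ᵇ n, unlike _≤ᵇ_.
  Chain : ℕ → Set
  Chain zero    = Unit.⊤
  Chain (suc n) = Fin (suc n) × Chain n

  infix 7 _∈ᵇ_
  _∈ᵇ_ : ∀ {n} → Subset n → Chain n → Bool
  []          ∈ᵇ _       = true
  (outside ∷ A) ∈ᵇ (j , c) = (A ∈ᵇ c) ∧ (∣ A ∣ <ᵇ suc (toℕ j))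
  (inside  ∷ A) ∈ᵇ (j , c) = (A ∈ᵇ c) ∧ (toℕ j <ᵇ suc ∣ A ∣)

  ∑ᶜ : ∀ n → (Chain n → ℕ) → ℕ
  ∑ᶜ zero    f = f tt
  ∑ᶜ (suc n) f = ∑[ j < suc n ] ∑ᶜ n (λ c → f (j , c))

  ∑ᶜ-cong : ∀ n {f g : Chain n → ℕ} → (∀ c → f c ≡ g c) → ∑ᶜ n f ≡ ∑ᶜ n g
  ∑ᶜ-cong zero    f≗g = f≗g tt
  ∑ᶜ-cong (suc n) f≗g = sum-cong-≗ {suc n} (λ j → ∑ᶜ-cong n (λ c → f≗g (j , c)))

  ∑ᶜ-mono-≤ : ∀ n {f g : Chain n → ℕ} → (∀ c → f c ≤ g c) → ∑ᶜ n f ≤ ∑ᶜ n g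
  ∑ᶜ-mono-≤ zero    f≤g = f≤g tt
  ∑ᶜ-mono-≤ (suc n) f≤g = ∑-mono-≤ (λ j → ∑ᶜ-mono-≤ n (λ c → f≤g (j , c)))

  ∑ᶜ-distrib-+ : ∀ n (f g : Chain n → ℕ) → ∑ᶜ n (λ c → f c + g c) ≡ ∑ᶜ n f + ∑ᶜ n g
  ∑ᶜ-distrib-+ zero    f g = refl
  ∑ᶜ-distrib-+ (suc n) f g = trans (sum-cong-≗ (λ j → ∑ᶜ-distrib-+ n (λ c → f (j , c)) (λ c → g (j , c))))
                                   (∑-distrib-+ (λ j → ∑ᶜ n (λ c → f (j , c))) (λ j → ∑ᶜ n (λ c → g (j , c))))

  ∑ᶜ-*ʳ : ∀ n k (f : Chain n → ℕ) → ∑ᶜ n (λ c → f c * k) ≡ ∑ᶜ n f * k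
  ∑ᶜ-*ʳ zero    k f = refl
  ∑ᶜ-*ʳ (suc n) k f = trans (sum-cong-≗ (λ j → ∑ᶜ-*ʳ n k (λ c → f (j , c))))
                            (sym (*-distribʳ-sum k (λ j → ∑ᶜ n (λ c → f (j , c)))))

  ∑ᶜ-const : ∀ n k → ∑ᶜ n (λ _ → k) ≡ n ! * k
  ∑ᶜ-const zero    k = sym (+-identityʳ k)
  ∑ᶜ-const (suc n) k = begin
    ∑[ j < suc n ] ∑ᶜ n (λ _ → k)   ≡⟨ sum-cong-≗ {suc n} (λ _ → ∑ᶜ-const n k) ⟩
    ∑[ j < suc n ] (n ! * k)        ≡⟨ ∑-const (suc n) (n ! * k) ⟩
    suc n * (n ! * k)               ≡⟨ *-assoc (suc n) (n !) k ⟨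
    suc n ! * k                     ∎
    where open ≡-Reasoning

  <ᵇsuc⇒≤ : ∀ {m n} → T (m <ᵇ suc n) → m ≤ n
  <ᵇsuc⇒≤ {m} {n} h = s≤s⁻¹ (<ᵇ⇒< m (suc n) h)

  ∈ᵇ-⊆ : ∀ {n} (c : Chain n) {A B : Subset n} → T (A ∈ᵇ c) → T (B ∈ᵇ c) → ∣ A ∣ ≤ ∣ B ∣ → A ⊆ B
  ∈ᵇ-⊆ {zero}  _       {[]}          {[]}          _  _  _ = λ x∈ → x∈
  ∈ᵇ-⊆ {suc n} (j , c) {outside ∷ A} {outside ∷ B} hA hB ∣A∣≤∣B∣ =
    let A∈c , _ = to T-∧ hA ; B∈c , _ = to T-∧ hB in out⊆ (∈ᵇ-⊆ c A∈c B∈c ∣A∣≤∣B∣)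
  ∈ᵇ-⊆ {suc n} (j , c) {outside ∷ A} {inside  ∷ B} hA hB _ =
    let A∈c , ∣A∣≤j = to T-∧ hA ; B∈c , j≤∣B∣ = to T-∧ hB
    in out⊆ (∈ᵇ-⊆ c A∈c B∈c (≤-trans (<ᵇsuc⇒≤ ∣A∣≤j) (<ᵇsuc⇒≤ j≤∣B∣)))
  ∈ᵇ-⊆ {suc n} (j , c) {inside  ∷ A} {inside  ∷ B} hA hB ∣A∣≤∣B∣ =
    let A∈c , _ = to T-∧ hA ; B∈c , _ = to T-∧ hB in in⊆in (∈ᵇ-⊆ c A∈c B∈c (s≤s⁻¹ ∣A∣≤∣B∣))
  ∈ᵇ-⊆ {suc n} (j , c) {inside  ∷ A} {outside ∷ B} hA hB ∣A∣<∣B∣ =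
    let _ , j≤∣A∣ = to T-∧ hA ; _ , ∣B∣≤j = to T-∧ hB
    in contradiction (≤-trans ∣A∣<∣B∣ (≤-trans (<ᵇsuc⇒≤ ∣B∣≤j) (<ᵇsuc⇒≤ j≤∣A∣))) (n≮n ∣ A ∣)

  ∈ᵇ-comparable : ∀ {n} (c : Chain n) {A B : Subset n} → T (A ∈ᵇ c) → T (B ∈ᵇ c) → A ⊆ B ⊎ B ⊆ A
  ∈ᵇ-comparable c {A} {B} A∈c B∈c with ≤-total ∣ A ∣ ∣ B ∣
  ... | inj₁ ∣A∣≤∣B∣ = inj₁ (∈ᵇ-⊆ c A∈c B∈c ∣A∣≤∣B∣)
  ... | inj₂ ∣B∣≤∣A∣ = inj₂ (∈ᵇ-⊆ c B∈c A∈c ∣B∣≤∣A∣)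

  ∑ᶜ-suc-∧ : ∀ n (p q : Chain n → Bool) (u v : Fin (suc n) → Bool) →
    ∑ᶜ (suc n) (λ (j , c) → 𝟙 ((p c ∧ u j) ∧ (q c ∧ v j)))
      ≡ ∑ᶜ n (λ c → 𝟙 (p c ∧ q c)) * ∑[ j < suc n ] 𝟙 (u j ∧ v j)
  ∑ᶜ-suc-∧ n p q u v = begin
    ∑[ j < suc n ] ∑ᶜ n (λ c → 𝟙 ((p c ∧ u j) ∧ (q c ∧ v j)))
      ≡⟨ sum-cong-≗ {suc n} (λ j → ∑ᶜ-cong n (λ c → 𝟙-∧-interchange (p c) (q c) (u j) (v j))) ⟩
    ∑[ j < suc n ] ∑ᶜ n (λ c → 𝟙 (p c ∧ q c) * 𝟙 (u j ∧ v j))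
      ≡⟨ sum-cong-≗ {suc n} (λ j → ∑ᶜ-*ʳ n (𝟙 (u j ∧ v j)) (λ c → 𝟙 (p c ∧ q c))) ⟩
    ∑[ j < suc n ] (P * 𝟙 (u j ∧ v j))
      ≡⟨ *-distribˡ-sum P (λ j → 𝟙 (u j ∧ v j)) ⟨
    P * ∑[ j < suc n ] 𝟙 (u j ∧ v j) ∎
    where
    open ≡-Reasoning
    P = ∑ᶜ n (λ c → 𝟙 (p c ∧ q c))

  ∑ᶜ-∈ᵇ-pair : ∀ {n} {A B : Subset n} → A ⊆ B →
    ∑ᶜ n (λ c → 𝟙 (A ∈ᵇ c ∧ B ∈ᵇ c)) ≡ ∣ A ∣ ! * (∣ B ∣ ∸ ∣ A ∣) ! * (n ∸ ∣ B ∣) !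
  ∑ᶜ-∈ᵇ-pair {zero}  {[]}          {[]}          _   = refl
  ∑ᶜ-∈ᵇ-pair {suc n} {outside ∷ A} {outside ∷ B} A⊆B = begin
    ∑ᶜ (suc n) (λ c → 𝟙 ((outside ∷ A) ∈ᵇ c ∧ (outside ∷ B) ∈ᵇ c))
      ≡⟨ ∑ᶜ-suc-∧ n (A ∈ᵇ_) (B ∈ᵇ_) (λ j → a <ᵇ suc (toℕ j)) (λ j → b <ᵇ suc (toℕ j)) ⟩
    ∑ᶜ n (λ c → 𝟙 (A ∈ᵇ c ∧ B ∈ᵇ c)) * ∑[ j < suc n ] 𝟙 ((a <ᵇ suc (toℕ j)) ∧ (b <ᵇ suc (toℕ j)))
      ≡⟨ cong₂ _*_ (∑ᶜ-∈ᵇ-pair (drop-∷-⊆ A⊆B)) (∑-above (suc n) a b (p⊆q⇒∣p∣≤∣q∣ (drop-∷-⊆ A⊆B))) ⟩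
    a ! * (b ∸ a) ! * (n ∸ b) ! * (suc n ∸ b)   ≡⟨ cong (λ k → a ! * (b ∸ a) ! * (n ∸ b) ! * k) n+1∸b ⟩
    a ! * (b ∸ a) ! * (n ∸ b) ! * suc (n ∸ b)   ≡⟨ rearrange (a !) ((b ∸ a) !) ((n ∸ b) !) (n ∸ b) ⟩
    a ! * (b ∸ a) ! * suc (n ∸ b) !             ≡⟨ cong (λ k → a ! * (b ∸ a) ! * k !) n+1∸b ⟨
    a ! * (b ∸ a) ! * (suc n ∸ b) !             ∎
    where
    open ≡-Reasoning
    a = ∣ A ∣ ; b = ∣ B ∣
    n+1∸b : suc n ∸ b ≡ suc (n ∸ b)
    n+1∸b = +-∸-assoc 1 (∣p∣≤n B)
    rearrange : ∀ x y z e → x * y * z * suc e ≡ x * y * (suc e * z)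
    rearrange = solve-∀
  ∑ᶜ-∈ᵇ-pair {suc n} {outside ∷ A} {inside ∷ B} A⊆B = begin
    ∑ᶜ (suc n) (λ c → 𝟙 ((outside ∷ A) ∈ᵇ c ∧ (inside ∷ B) ∈ᵇ c))
      ≡⟨ ∑ᶜ-suc-∧ n (A ∈ᵇ_) (B ∈ᵇ_) (λ j → a <ᵇ suc (toℕ j)) (λ j → toℕ j <ᵇ suc b) ⟩
    ∑ᶜ n (λ c → 𝟙 (A ∈ᵇ c ∧ B ∈ᵇ c)) * ∑[ j < suc n ] 𝟙 ((a <ᵇ suc (toℕ j)) ∧ (toℕ j <ᵇ suc b))
      ≡⟨ cong₂ _*_ (∑ᶜ-∈ᵇ-pair (drop-∷-⊆ A⊆B)) (∑-between (suc n) a b (m≤n⇒m≤1+n a≤b) (s≤s (∣p∣≤n B))) ⟩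
    a ! * (b ∸ a) ! * (n ∸ b) ! * (suc b ∸ a)   ≡⟨ cong (λ k → a ! * (b ∸ a) ! * (n ∸ b) ! * k) b+1∸a ⟩
    a ! * (b ∸ a) ! * (n ∸ b) ! * suc (b ∸ a)   ≡⟨ rearrange (a !) ((b ∸ a) !) ((n ∸ b) !) (b ∸ a) ⟩
    a ! * suc (b ∸ a) ! * (n ∸ b) !             ≡⟨ cong (λ k → a ! * k ! * (n ∸ b) !) b+1∸a ⟨
    a ! * (suc b ∸ a) ! * (n ∸ b) !             ∎
    where
    open ≡-Reasoning
    a = ∣ A ∣ ; b = ∣ B ∣
    a≤b : a ≤ b
    a≤b = p⊆q⇒∣p∣≤∣q∣ (drop-∷-⊆ A⊆B)
    b+1∸a : suc b ∸ a ≡ suc (b ∸ a)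
    b+1∸a = +-∸-assoc 1 a≤b
    rearrange : ∀ x y z d → x * y * z * suc d ≡ x * (suc d * y) * z
    rearrange = solve-∀
  ∑ᶜ-∈ᵇ-pair {suc n} {inside ∷ A} {inside ∷ B} A⊆B = begin
    ∑ᶜ (suc n) (λ c → 𝟙 ((inside ∷ A) ∈ᵇ c ∧ (inside ∷ B) ∈ᵇ c))
      ≡⟨ ∑ᶜ-suc-∧ n (A ∈ᵇ_) (B ∈ᵇ_) (λ j → toℕ j <ᵇ suc a) (λ j → toℕ j <ᵇ suc b) ⟩
    ∑ᶜ n (λ c → 𝟙 (A ∈ᵇ c ∧ B ∈ᵇ c)) * ∑[ j < suc n ] 𝟙 ((toℕ j <ᵇ suc a) ∧ (toℕ j <ᵇ suc b))
      ≡⟨ cong₂ _*_ (∑ᶜ-∈ᵇ-pair (drop-∷-⊆ A⊆B)) (∑-below (suc n) a b a≤b (s≤s (∣p∣≤n A))) ⟩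
    a ! * (b ∸ a) ! * (n ∸ b) ! * suc a         ≡⟨ rearrange (a !) ((b ∸ a) !) ((n ∸ b) !) a ⟩
    suc a ! * (b ∸ a) ! * (n ∸ b) !             ∎
    where
    open ≡-Reasoning
    a = ∣ A ∣ ; b = ∣ B ∣
    a≤b : a ≤ b
    a≤b = p⊆q⇒∣p∣≤∣q∣ (drop-∷-⊆ A⊆B)
    rearrange : ∀ x y z a → x * y * z * suc a ≡ suc a * x * y * z
    rearrange = solve-∀
  ∑ᶜ-∈ᵇ-pair {suc n} {inside ∷ A} {outside ∷ B} A⊆B = contradiction (A⊆B here) λ ()

  ⊆∧∣∣≡⇒≡ : ∀ {n} {A B : Subset n} → A ⊆ B → ∣ A ∣ ≡ ∣ B ∣ → A ≡ B
  ⊆∧∣∣≡⇒≡ {A = []}          {[]}          _   _ = refl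
  ⊆∧∣∣≡⇒≡ {A = outside ∷ A} {outside ∷ B} A⊆B e = cong (outside ∷_) (⊆∧∣∣≡⇒≡ (drop-∷-⊆ A⊆B) e)
  ⊆∧∣∣≡⇒≡ {A = outside ∷ A} {inside  ∷ B} A⊆B e =
    contradiction (subst (_≤ ∣ B ∣) e (p⊆q⇒∣p∣≤∣q∣ (drop-∷-⊆ A⊆B))) (n≮n ∣ B ∣)
  ⊆∧∣∣≡⇒≡ {A = inside  ∷ A} {outside ∷ B} A⊆B e = contradiction (A⊆B here) λ ()
  ⊆∧∣∣≡⇒≡ {A = inside  ∷ A} {inside  ∷ B} A⊆B e = cong (inside ∷_) (⊆∧∣∣≡⇒≡ (drop-∷-⊆ A⊆B) (suc-injective e))

  ⊆∧≢⇒∣∣< : ∀ {n} {A B : Subset n} → A ⊆ B → A ≢ B → ∣ A ∣ < ∣ B ∣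
  ⊆∧≢⇒∣∣< A⊆B A≢B = ≤∧≢⇒< (p⊆q⇒∣p∣≤∣q∣ A⊆B) (A≢B ∘ ⊆∧∣∣≡⇒≡ A⊆B)

  ≢⊥⇒0<∣∣ : ∀ {n} {A : Subset n} → A ≢ ⊥ → 0 < ∣ A ∣
  ≢⊥⇒0<∣∣ {n} {A} A≢⊥ = subst (_< ∣ A ∣) (∣⊥∣≡0 n) (⊆∧≢⇒∣∣< (⊆-min A) (A≢⊥ ∘ sym))

  ≢⊤⇒∣∣<n : ∀ {n} {A : Subset n} → A ≢ ⊤ → ∣ A ∣ < n
  ≢⊤⇒∣∣<n {n} {A} A≢⊤ = subst (∣ A ∣ <_) (∣⊤∣≡n n) (⊆∧≢⇒∣∣< (⊆-max A) A≢⊤)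

  [1+a]!*[1+b]!≤[1+a+b]! : ∀ a b → suc a ! * suc b ! ≤ suc (a + b) !
  [1+a]!*[1+b]!≤[1+a+b]! a zero    = ≤-reflexive (trans (*-identityʳ (suc a !)) (cong (λ k → suc k !) (sym (+-identityʳ a))))
  [1+a]!*[1+b]!≤[1+a+b]! a (suc b) = begin
    suc a ! * (suc (suc b) * suc b !)   ≡⟨ x∙yz≈y∙xz (suc a !) (suc (suc b)) (suc b !) ⟩
    suc (suc b) * (suc a ! * suc b !)   ≤⟨ *-mono-≤ (s≤s (s≤s (m≤n+m b a))) ([1+a]!*[1+b]!≤[1+a+b]! a b) ⟩
    suc (suc (a + b)) * suc (a + b) !   ≡⟨ cong (λ k → suc k !) (+-suc a b) ⟨
    suc (a + suc b) !                   ∎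
    where open ≤-Reasoning

  k!*[1+n∸k]!≤n! : ∀ {k n} → 0 < k → k < suc n → k ! * (suc n ∸ k) ! ≤ n !
  k!*[1+n∸k]!≤n! {suc a} {n} _ (s≤s a<n) = begin
    suc a ! * (n ∸ a) !           ≡⟨ cong (λ k → suc a ! * k !) (+-∸-assoc 1 a<n) ⟩
    suc a ! * suc (n ∸ suc a) !   ≤⟨ [1+a]!*[1+b]!≤[1+a+b]! a (n ∸ suc a) ⟩
    suc (a + (n ∸ suc a)) !       ≡⟨ cong _! (m+[n∸m]≡n a<n) ⟩
    n !                           ∎
    where open ≤-Reasoning

  a!*[b∸a]!*[2+n∸b]!≤n! : ∀ {a b n} → 0 < a → a < b → b < suc (suc n) →
    a ! * (b ∸ a) ! * (suc (suc n) ∸ b) ! ≤ n !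
  a!*[b∸a]!*[2+n∸b]!≤n! {a} {suc b} {n} 0<a (s≤s a≤b) (s≤s b<1+n) = begin
    a ! * (suc b ∸ a) ! * (suc n ∸ b) !   ≤⟨ *-monoˡ-≤ ((suc n ∸ b) !) (k!*[1+n∸k]!≤n! 0<a (s≤s a≤b)) ⟩
    b ! * (suc n ∸ b) !                   ≤⟨ k!*[1+n∸k]!≤n! (≤-trans 0<a a≤b) b<1+n ⟩
    n !                                   ∎
    where open ≤-Reasoning

  -- The upper bound

  ∑ᶜ-∈ᵇ : ∀ {n} (A : Subset n) → ∑ᶜ n (λ c → 𝟙 (A ∈ᵇ c)) ≡ ∣ A ∣ ! * (n ∸ ∣ A ∣) !
  ∑ᶜ-∈ᵇ {n} A = begin
    ∑ᶜ n (λ c → 𝟙 (A ∈ᵇ c))             ≡⟨ ∑ᶜ-cong n (λ c → cong 𝟙 (∧-idem (A ∈ᵇ c))) ⟨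
    ∑ᶜ n (λ c → 𝟙 (A ∈ᵇ c ∧ A ∈ᵇ c))    ≡⟨ ∑ᶜ-∈ᵇ-pair {n} {A} ⊆-refl ⟩
    ∣ A ∣ ! * (∣ A ∣ ∸ ∣ A ∣) ! * (n ∸ ∣ A ∣) ! ≡⟨ cong (λ k → ∣ A ∣ ! * k ! * (n ∸ ∣ A ∣) !) (n∸n≡0 ∣ A ∣) ⟩
    ∣ A ∣ ! * 1 * (n ∸ ∣ A ∣) !          ≡⟨ cong (_* (n ∸ ∣ A ∣) !) (*-identityʳ (∣ A ∣ !)) ⟩
    ∣ A ∣ ! * (n ∸ ∣ A ∣) !              ∎
    where open ≡-Reasoning

  weight : ∀ {n} → List (Subset n) → ℕ
  weight     []      = 0
  weight {n} (A ∷ F) = ∣ A ∣ ! * (n ∸ ∣ A ∣) ! + weight F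

  ∑ᶜ-count : ∀ n (F : List (Subset n)) → ∑ᶜ n (λ c → count (_∈ᵇ c) F) ≡ weight F
  ∑ᶜ-count n []      = trans (∑ᶜ-const n 0) (*-zeroʳ (n !))
  ∑ᶜ-count n (A ∷ F) = trans (∑ᶜ-distrib-+ n (λ c → 𝟙 (A ∈ᵇ c)) (λ c → count (_∈ᵇ c) F))
                             (cong₂ _+_ (∑ᶜ-∈ᵇ A) (∑ᶜ-count n F))

  nCk*[k!*[n∸k]!]≡n! : ∀ {n k} → k ≤ n → (n C k) * (k ! * (n ∸ k) !) ≡ n !
  nCk*[k!*[n∸k]!]≡n! {n} {k} k≤n = trans (cong (_* (k ! * (n ∸ k) !)) (nCk≡n!/k![n-k]! k≤n))
                                         (m/n*n≡m {{k !* (n ∸ k) !≢0}} (k![n∸k]!∣n! k≤n))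

  lu≡weight*recip[n!] : ∀ n (F : List (Subset n)) → lu n F ≡ fromℕ (weight F) ℚ.* recip (n !)
  lu≡weight*recip[n!] n []      = sym (ℚₚ.*-zeroˡ (recip (n !)))
  lu≡weight*recip[n!] n (A ∷ F) = begin
    recip (n C ∣ A ∣) ℚ.+ lu n F
      ≡⟨ cong₂ ℚ._+_ (recip-* {n C ∣ A ∣} {{n !≢0}} (nCk*[k!*[n∸k]!]≡n! (∣p∣≤n A))) (lu≡weight*recip[n!] n F) ⟩
    fromℕ w ℚ.* r ℚ.+ fromℕ (weight F) ℚ.* r   ≡⟨ ℚₚ.*-distribʳ-+ r (fromℕ w) (fromℕ (weight F)) ⟨
    (fromℕ w ℚ.+ fromℕ (weight F)) ℚ.* r       ≡⟨ cong (ℚ._* r) (fromℕ-+ w (weight F)) ⟨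
    fromℕ (w + weight F) ℚ.* r                 ∎
    where
    open ≡-Reasoning
    w = ∣ A ∣ ! * (n ∸ ∣ A ∣) !
    r = recip (n !)

  Comparable : ∀ {n} → Subset n → Subset n → Set
  Comparable A B = A ⊆ B ⊎ B ⊆ A

  comparable? : ∀ {n} → Decidable (Comparable {n})
  comparable? A B = A ⊆? B ⊎-dec B ⊆? A

  module ComparabilityGraph {n} (F : List (Subset n)) =
    TwoMatchingFreeGraph (≡-dec _≟ᵇ_) comparable? swap F
  open ComparabilityGraph using (edge; edge-sym; Edge; TwoMatchingFree; Shape; edgeless; star; triangle; shape; excess; count-≤-excess)
  open Edge

  M₂-embedding : ∀ {N F} {a b c d : Subset N} → Edge F a b → Edge F c d → a ⊆ b → c ⊆ d →
    a ≢ c × a ≢ d × b ≢ c × b ≢ d → ¬ M₂-free N F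
  M₂-embedding {N} {F} {a} {b} {c} {d} eab ecd a⊆b c⊆d (a≢c , a≢d , b≢c , b≢d) M₂-free =
    M₂-free (f , f-injective , f∈F , f-mono)
    where
    f : Fin 4 → Subset N
    f 0F = a
    f 1F = c
    f 2F = b
    f 3F = d
    f∈F : ∀ i → f i ∈ F
    f∈F 0F = ∈ˡ eab
    f∈F 1F = ∈ˡ ecd
    f∈F 2F = ∈ʳ eab
    f∈F 3F = ∈ʳ ecd
    f-mono : ∀ {i j} → i ≤M₂ j → f i ⊆ f j
    f-mono refl≤ = λ x∈ → x∈
    f-mono x₁≤y₁ = a⊆b
    f-mono x₂≤y₂ = c⊆d
    f-injective : Injective _≡_ _≡_ f
    f-injective {0F} {0F} _ = refl
    f-injective {0F} {1F} e = ⊥-elim (a≢c e)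
    f-injective {0F} {2F} e = ⊥-elim (distinct eab e)
    f-injective {0F} {3F} e = ⊥-elim (a≢d e)
    f-injective {1F} {0F} e = ⊥-elim (a≢c (sym e))
    f-injective {1F} {1F} _ = refl
    f-injective {1F} {2F} e = ⊥-elim (b≢c (sym e))
    f-injective {1F} {3F} e = ⊥-elim (distinct ecd e)
    f-injective {2F} {0F} e = ⊥-elim (distinct eab (sym e))
    f-injective {2F} {1F} e = ⊥-elim (b≢c e)
    f-injective {2F} {2F} _ = refl
    f-injective {2F} {3F} e = ⊥-elim (b≢d e)
    f-injective {3F} {0F} e = ⊥-elim (a≢d (sym e))
    f-injective {3F} {1F} e = ⊥-elim (distinct ecd (sym e))
    f-injective {3F} {2F} e = ⊥-elim (b≢d (sym e))
    f-injective {3F} {3F} _ = refl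

  M₂-free⇒two-matching-free : ∀ {N F} → M₂-free N F → TwoMatchingFree F
  M₂-free⇒two-matching-free {F = F} M₂-free ePQ eRS (P≢R , P≢S , Q≢R , Q≢S) with adjacent ePQ | adjacent eRS
  ... | inj₁ P⊆Q | inj₁ R⊆S = M₂-embedding ePQ eRS P⊆Q R⊆S (P≢R , P≢S , Q≢R , Q≢S) M₂-free
  ... | inj₂ Q⊆P | inj₁ R⊆S = M₂-embedding (edge-sym F ePQ) eRS Q⊆P R⊆S (Q≢R , Q≢S , P≢R , P≢S) M₂-free
  ... | inj₁ P⊆Q | inj₂ S⊆R = M₂-embedding ePQ (edge-sym F eRS) P⊆Q S⊆R (P≢S , P≢R , Q≢S , Q≢R) M₂-free
  ... | inj₂ Q⊆P | inj₂ S⊆R = M₂-embedding (edge-sym F ePQ) (edge-sym F eRS) Q⊆P S⊆R (Q≢S , Q≢R , P≢S , P≢R) M₂-free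

  ∑ᶜ-∈ᵇ≤ : ∀ {m} {Z : Subset (suc m)} → Z ≢ ⊥ → Z ≢ ⊤ → ∑ᶜ (suc m) (λ c → 𝟙 (Z ∈ᵇ c)) ≤ m !
  ∑ᶜ-∈ᵇ≤ {m} {Z} Z≢⊥ Z≢⊤ = begin
    ∑ᶜ (suc m) (λ c → 𝟙 (Z ∈ᵇ c))   ≡⟨ ∑ᶜ-∈ᵇ Z ⟩
    ∣ Z ∣ ! * (suc m ∸ ∣ Z ∣) !      ≤⟨ k!*[1+n∸k]!≤n! (≢⊥⇒0<∣∣ Z≢⊥) (≢⊤⇒∣∣<n Z≢⊤) ⟩
    m !                               ∎
    where open ≤-Reasoning

  ∑ᶜ-∈ᵇ-pair≤ : ∀ {m} {P Q : Subset (suc (suc m))} → P ⊆ Q → P ≢ Q → P ≢ ⊥ → Q ≢ ⊤ →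
    ∑ᶜ (suc (suc m)) (λ c → 𝟙 (P ∈ᵇ c ∧ Q ∈ᵇ c)) ≤ m !
  ∑ᶜ-∈ᵇ-pair≤ {m} {P} {Q} P⊆Q P≢Q P≢⊥ Q≢⊤ = begin
    ∑ᶜ (suc (suc m)) (λ c → 𝟙 (P ∈ᵇ c ∧ Q ∈ᵇ c))                ≡⟨ ∑ᶜ-∈ᵇ-pair P⊆Q ⟩
    ∣ P ∣ ! * (∣ Q ∣ ∸ ∣ P ∣) ! * (suc (suc m) ∸ ∣ Q ∣) !
      ≤⟨ a!*[b∸a]!*[2+n∸b]!≤n! (≢⊥⇒0<∣∣ P≢⊥) (⊆∧≢⇒∣∣< P⊆Q P≢Q) (≢⊤⇒∣∣<n Q≢⊤) ⟩
    m !                                                           ∎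
    where open ≤-Reasoning

  ∑ᶜ-edge≤ : ∀ {m F} → Admissible (suc (suc m)) F → ∀ {P Q} → Edge F P Q →
    ∑ᶜ (suc (suc m)) (λ c → 𝟙 (P ∈ᵇ c ∧ Q ∈ᵇ c)) ≤ m !
  ∑ᶜ-edge≤ {m} (_ , non⊥ , non⊤ , _) {P} {Q} ePQ with adjacent ePQ
  ... | inj₁ P⊆Q = ∑ᶜ-∈ᵇ-pair≤ P⊆Q (distinct ePQ) (non⊥ (∈ˡ ePQ)) (non⊤ (∈ʳ ePQ))
  ... | inj₂ Q⊆P = subst (_≤ m !) (∑ᶜ-cong (suc (suc m)) λ c → cong 𝟙 (∧-comm (Q ∈ᵇ c) (P ∈ᵇ c)))
                         (∑ᶜ-∈ᵇ-pair≤ Q⊆P (distinct ePQ ∘ sym) (non⊥ (∈ʳ ePQ)) (non⊤ (∈ˡ ePQ)))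

  ∑ᶜ-excess≤ : ∀ {m F} → 2 ≤ m → Admissible (suc (suc m)) F → ∀ s →
    ∑ᶜ (suc (suc m)) (λ c → excess F s (_∈ᵇ c)) ≤ suc m !
  ∑ᶜ-excess≤ {m} _ _ (edgeless _) =
    ≤-trans (≤-reflexive (trans (∑ᶜ-const (suc (suc m)) 0) (*-zeroʳ (suc (suc m) !)))) z≤n
  ∑ᶜ-excess≤ _ (_ , non⊥ , non⊤ , _) (star Z Z∈ _) = ∑ᶜ-∈ᵇ≤ (non⊥ Z∈) (non⊤ Z∈)
  ∑ᶜ-excess≤ {m} 2≤m adm (triangle X Y W eXY eXW eYW _) = begin
    ∑ᶜ N (λ c → pair X Y c + pair X W c + pair Y W c)
      ≡⟨ ∑ᶜ-distrib-+ N (λ c → pair X Y c + pair X W c) (pair Y W) ⟩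
    ∑ᶜ N (λ c → pair X Y c + pair X W c) + ∑ᶜ N (pair Y W)
      ≡⟨ cong (_+ ∑ᶜ N (pair Y W)) (∑ᶜ-distrib-+ N (pair X Y) (pair X W)) ⟩
    ∑ᶜ N (pair X Y) + ∑ᶜ N (pair X W) + ∑ᶜ N (pair Y W)
      ≤⟨ +-mono-≤ (+-mono-≤ (∑ᶜ-edge≤ adm eXY) (∑ᶜ-edge≤ adm eXW)) (∑ᶜ-edge≤ adm eYW) ⟩
    m ! + m ! + m !
      ≡⟨ x+x+x≡3x (m !) ⟩
    3 * m !
      ≤⟨ *-monoˡ-≤ (m !) (s≤s 2≤m) ⟩
    suc m ! ∎
    where
    open ≤-Reasoning
    N = suc (suc m)
    pair : Subset N → Subset N → Chain N → ℕ
    pair A B c = 𝟙 (A ∈ᵇ c ∧ B ∈ᵇ c)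
    x+x+x≡3x : ∀ x → x + x + x ≡ 3 * x
    x+x+x≡3x = solve-∀

  weight≤ : ∀ {m F} → 2 ≤ m → Admissible (suc (suc m)) F → weight F ≤ suc (suc m) ! + suc m !
  weight≤ {m} {F} 2≤m adm@(uniq , _ , _ , M₂-free) = begin
    weight F                                                ≡⟨ ∑ᶜ-count N F ⟨
    ∑ᶜ N (λ c → count (_∈ᵇ c) F)
      ≤⟨ ∑ᶜ-mono-≤ N (λ c → count-≤-excess F uniq (_∈ᵇ c) (λ _ _ → ∈ᵇ-comparable c) s) ⟩
    ∑ᶜ N (λ c → 1 + excess F s (_∈ᵇ c))
      ≡⟨ ∑ᶜ-distrib-+ N (λ _ → 1) (λ c → excess F s (_∈ᵇ c)) ⟩
    ∑ᶜ N (λ _ → 1) + ∑ᶜ N (λ c → excess F s (_∈ᵇ c))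
      ≤⟨ +-mono-≤ (≤-reflexive (trans (∑ᶜ-const N 1) (*-identityʳ (N !)))) (∑ᶜ-excess≤ 2≤m adm s) ⟩
    N ! + suc m ! ∎
    where
    open ≤-Reasoning
    N = suc (suc m)
    s = shape F (M₂-free⇒two-matching-free M₂-free)

  lu≤1+1/N : ∀ {N} → 4 ≤ N → ∀ F → Admissible N F → lu N F ℚ.≤ 1ℚ ℚ.+ recip N
  lu≤1+1/N {suc (suc m)} (s≤s (s≤s 2≤m)) F adm = begin
    lu N F                                       ≡⟨ lu≡weight*recip[n!] N F ⟩
    fromℕ (weight F) ℚ.* r                       ≤⟨ ℚₚ.*-monoʳ-≤-nonNeg r {{recip-nonNeg (N !)}} (fromℕ-mono-≤ (weight≤ 2≤m adm)) ⟩
    fromℕ (N ! + suc m !) ℚ.* r                  ≡⟨ cong (ℚ._* r) (fromℕ-+ (N !) (suc m !)) ⟩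
    (fromℕ (N !) ℚ.+ fromℕ (suc m !)) ℚ.* r      ≡⟨ ℚₚ.*-distribʳ-+ r (fromℕ (N !)) (fromℕ (suc m !)) ⟩
    fromℕ (N !) ℚ.* r ℚ.+ fromℕ (suc m !) ℚ.* r  ≡⟨ cong₂ ℚ._+_ (recip-inverseʳ (N !) {{N !≢0}}) (sym (recip-* {N} {{N !≢0}} refl)) ⟩
    1ℚ ℚ.+ recip N                                ∎
    where
    open ℚₚ.≤-Reasoning
    N = suc (suc m)
    r = recip (N !)

  -- A family attaining the bound

  lu-tabulate : ∀ {n k s} (g : Fin k → Subset n) → (∀ i → ∣ g i ∣ ≡ s) →
    lu n (tabulate g) ≡ fromℕ k ℚ.* recip (n C s)
  lu-tabulate {n} {zero}  {s} g _   = sym (ℚₚ.*-zeroˡ (recip (n C s)))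
  lu-tabulate {n} {suc k} {s} g ∣g∣ = begin
    recip (n C ∣ g zero ∣) ℚ.+ lu n (tabulate (g ∘ suc))
      ≡⟨ cong₂ ℚ._+_ (cong (λ x → recip (n C x)) (∣g∣ zero)) (lu-tabulate (g ∘ suc) (∣g∣ ∘ suc)) ⟩
    r ℚ.+ fromℕ k ℚ.* r            ≡⟨ cong (ℚ._+ fromℕ k ℚ.* r) (ℚₚ.*-identityˡ r) ⟨
    1ℚ ℚ.* r ℚ.+ fromℕ k ℚ.* r     ≡⟨ ℚₚ.*-distribʳ-+ r 1ℚ (fromℕ k) ⟨
    (1ℚ ℚ.+ fromℕ k) ℚ.* r         ≡⟨ cong (ℚ._* r) (fromℕ-+ 1 k) ⟨
    fromℕ (suc k) ℚ.* r            ∎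
    where
    open ≡-Reasoning
    r = recip (n C s)

  coatom : ∀ {n} → Fin n → Subset n
  coatom i = ∁ ⁅ i ⁆

  ∣coatom∣ : ∀ {n} (i : Fin n) → ∣ coatom i ∣ ≡ n ∸ 1
  ∣coatom∣ {n} i = trans (∣∁p∣≡n∸∣p∣ ⁅ i ⁆) (cong (n ∸_) (∣⁅x⁆∣≡1 i))

  coatom-⊆ : ∀ {n} {i j : Fin n} → coatom i ⊆ coatom j → i ≡ j
  coatom-⊆ {i = i} {j} ci⊆cj with i ≟ᶠ j
  ... | yes i≡j = i≡j
  ... | no  i≢j = contradiction (ci⊆cj j∈ci) (λ j∈cj → x∈∁p⇒x∉p j∈cj (x∈⁅x⁆ j))
    where
    j∈ci : j ∈ₛ coatom i
    j∈ci = x∉p⇒x∈∁p (λ j∈⁅i⁆ → i≢j (sym (x∈⁅y⁆⇒x≡y i j∈⁅i⁆)))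

  module ExtremalFamily (m : ℕ) where

    N : ℕ
    N = suc (suc (suc m))

    ⁅0⁆ : Subset N
    ⁅0⁆ = ⁅ zero ⁆

    F₀ : List (Subset N)
    F₀ = ⁅0⁆ ∷ tabulate coatom

    ≢-by-size : ∀ {A B : Subset N} → ∣ A ∣ ≢ ∣ B ∣ → A ≢ B
    ≢-by-size ∣A∣≢∣B∣ = ∣A∣≢∣B∣ ∘ cong ∣_∣

    member : ∀ {A} → A ∈ F₀ → A ≡ ⁅0⁆ ⊎ Σ (Fin N) (λ i → A ≡ coatom i)
    member (here  A≡⁅0⁆) = inj₁ A≡⁅0⁆
    member (there A∈)    = inj₂ (∈-tabulate⁻ A∈)

    ∣⁅0⁆∣ : ∣ ⁅0⁆ ∣ ≡ 1
    ∣⁅0⁆∣ = ∣⁅x⁆∣≡1 (zero {suc (suc m)})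

    ⁅0⁆≢coatom : ∀ i → ⁅0⁆ ≢ coatom i
    ⁅0⁆≢coatom i = ≢-by-size (subst₂ _≢_ (sym ∣⁅0⁆∣) (sym (∣coatom∣ i)) λ ())

    F₀-unique : Unique F₀
    F₀-unique = Allₚ.tabulate⁺ ⁅0⁆≢coatom ∷ Uniqueₚ.tabulate⁺ (λ e → coatom-⊆ (λ x∈ → subst (_ ∈ₛ_) e x∈))

    F₀-non⊥ : ∀ {A} → A ∈ F₀ → A ≢ ⊥
    F₀-non⊥ A∈ with member A∈
    ... | inj₁ refl       = ≢-by-size (subst₂ _≢_ (sym ∣⁅0⁆∣) (sym (∣⊥∣≡0 N)) λ ())
    ... | inj₂ (i , refl) = ≢-by-size (subst₂ _≢_ (sym (∣coatom∣ i)) (sym (∣⊥∣≡0 N)) λ ())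

    F₀-non⊤ : ∀ {A} → A ∈ F₀ → A ≢ ⊤
    F₀-non⊤ A∈ with member A∈
    ... | inj₁ refl       = ≢-by-size (subst₂ _≢_ (sym ∣⁅0⁆∣) (sym (∣⊤∣≡n N)) λ ())
    ... | inj₂ (i , refl) = ≢-by-size (subst₂ _≢_ (sym (∣coatom∣ i)) (sym (∣⊤∣≡n N)) λ ())

    strictly-below⇒⁅0⁆ : ∀ {P Q} → P ∈ F₀ → Q ∈ F₀ → P ⊆ Q → P ≢ Q → P ≡ ⁅0⁆
    strictly-below⇒⁅0⁆ P∈ Q∈ P⊆Q P≢Q with member P∈ | member Q∈
    ... | inj₁ P≡⁅0⁆      | _               = P≡⁅0⁆
    ... | inj₂ (i , refl) | inj₁ refl       = contradiction (subst₂ _≤_ (∣coatom∣ i) ∣⁅0⁆∣ (p⊆q⇒∣p∣≤∣q∣ P⊆Q)) λ { (s≤s ()) }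
    ... | inj₂ (i , refl) | inj₂ (j , refl) = contradiction (cong coatom (coatom-⊆ P⊆Q)) P≢Q

    F₀-M₂-free : M₂-free N F₀
    F₀-M₂-free (f , f-injective , f∈F₀ , f-mono) = contradiction (f-injective (trans fx₁≡⁅0⁆ (sym fx₂≡⁅0⁆))) λ ()
      where
      fx₁≡⁅0⁆ : f 0F ≡ ⁅0⁆
      fx₁≡⁅0⁆ = strictly-below⇒⁅0⁆ (f∈F₀ 0F) (f∈F₀ 2F) (f-mono x₁≤y₁) ((λ ()) ∘ f-injective)
      fx₂≡⁅0⁆ : f 1F ≡ ⁅0⁆
      fx₂≡⁅0⁆ = strictly-below⇒⁅0⁆ (f∈F₀ 1F) (f∈F₀ 3F) (f-mono x₂≤y₂) ((λ ()) ∘ f-injective)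

    lu-F₀ : lu N F₀ ≡ 1ℚ ℚ.+ recip N
    lu-F₀ = begin
      recip (N C ∣ ⁅0⁆ ∣) ℚ.+ lu N (tabulate coatom)   ≡⟨ cong₂ ℚ._+_ (cong recip NC∣⁅0⁆∣≡N) (lu-tabulate {N} coatom ∣coatom∣) ⟩
      recip N ℚ.+ fromℕ N ℚ.* recip (N C (N ∸ 1))     ≡⟨ cong (λ k → recip N ℚ.+ fromℕ N ℚ.* recip k) NC[N∸1]≡N ⟩
      recip N ℚ.+ fromℕ N ℚ.* recip N                  ≡⟨ cong (recip N ℚ.+_) (recip-inverseʳ N) ⟩
      recip N ℚ.+ 1ℚ                                   ≡⟨ ℚₚ.+-comm (recip N) 1ℚ ⟩
      1ℚ ℚ.+ recip N                                   ∎
      where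
      open ≡-Reasoning
      NC∣⁅0⁆∣≡N : N C ∣ ⁅0⁆ ∣ ≡ N
      NC∣⁅0⁆∣≡N = trans (cong (N C_) ∣⁅0⁆∣) (nC1≡n N)
      NC[N∸1]≡N : N C (N ∸ 1) ≡ N
      NC[N∸1]≡N = trans (nCk≡nC[n∸k] (m∸n≤m N 1)) (trans (cong (N C_) (m+n∸n≡m 1 (N ∸ 1))) (nC1≡n N))

  extremal-family : ∀ {N} → 3 ≤ N → Σ (List (Subset N)) (λ F → Admissible N F × lu N F ≡ 1ℚ ℚ.+ recip N)
  extremal-family {suc (suc (suc m))} (s≤s (s≤s (s≤s _))) = F₀ , (F₀-unique , F₀-non⊥ , F₀-non⊤ , F₀-M₂-free) , lu-F₀
    where open ExtremalFamily m

open LubellBound using (lu≤1+1/N; extremal-family)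

open import Data.Nat using (ℕ; _≤_)
open import Data.Rational using (ℚ; _+_; 1ℚ) renaming (_≤_ to _≤ℚ_)
open import Data.Fin.Subset using (Subset)
open import Data.List using (List)
open import Data.Product using (Σ; _×_; _,_)
open import Data.Nat.Properties using (≤-trans; n≤1+n)
open import Relation.Binary.PropositionalEquality using (_≡_)

lemma3p4 : (N : ℕ) → 5 ≤ N →
    ((F : List (Subset N)) → Admissible N F → lu N F ≤ℚ 1ℚ + recip N)
    × Σ (List (Subset N)) (λ F → Admissible N F × lu N F ≡ 1ℚ + recip N)
lemma3p4 N 5≤N = lu≤1+1/N 4≤N , extremal-family (≤-trans (n≤1+n 3) 4≤N)
  where
  4≤N : 4 ≤ N
  4≤N = ≤-trans (n≤1+n 4) 5≤N
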